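{- Let $(S,A,\to)$ be an image-finite labelled transition system, $s\in S$, $I$ an arbitrary index set and $\varphi_i\in{\it HML}$ for $i\in I$. (1) If $D[]$ is a positive context, then $s\models D[\bigwedge_{i\in I}\varphi_i]$ if and only if $s\models D[\bigwedge_{i\in J}\varphi_i]$ for all finite $J\subseteq I$. (2) If $D[]$ is a negative context, then $s\models D[\bigwedge_{i\in I}\varphi_i]$ if and only if $s\models D[\bigwedge_{i\in J}\varphi_i]$ for some finite $J\subseteq I$.
   Context: A labelled transition system consists of a set $S$ of states, a set $A$ of actions and transitions $s\xrightarrow{a}s'$; it is image-finite if for each $s$ and $a$ there are only finitely many transitions $s\xrightarrow{a}s'$. Hennessy-Milner logic ${\it HML}$ has formulas $\varphi ::= {\sf T} \mid \bigwedge_{i\in I}\varphi_i \mid \langle a\rangle\varphi \mid \neg\varphi$ ($a\in A$, $I$ arbitrary index set), with $s\models{\sf T}$; $s\models\bigwedge_{i\in I}\varphi_i$ iff $s\models\varphi_i$ for all $i$; $s\models\langle a\rangle\varphi$ iff some $s'$ with $s\xrightarrow{a}s'$ satisfies $\varphi$; $s\models\neg\varphi$ iff $s\not\models\varphi$. A context $D[]$ is a formula with exactly one occurrence of a hole $[]$ in place of a subformula. Positive and negative contexts are defined inductively: $[]$ is positive; if $D[]$ is positive (resp. negative), then $D[]\wedge\bigwedge_{i\in I}\varphi_i$ and $\langle a\rangle D[]$ are positive (resp. negative); if $D[]$ is positive (resp. negative) then $\neg D[]$ is negative (resp. positive). -}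

module Defs where

open import Level using (0ℓ)
open import Data.Bool using (Bool; true; false; not)
open import Data.Unit using (⊤; tt)
open import Data.Sum using (_⊎_; inj₁; inj₂)
open import Data.Product using (Σ; ∃; _×_; _,_)
open import Data.List using (List)
open import Data.List.Membership.Propositional using (_∈_)
open import Relation.Nullary using (¬_)
open import Function.Bundles using (_⇔_)

record LTS (A : Set) : Set₁ where
  field
    State : Set
    _⟶[_]_ : State → A → State → Set

ImageFinite : {A : Set} → LTS A → Set
ImageFinite {A} L = ∀ (s : State) (a : A) →
  Σ (List State) (λ succs → ∀ (s' : State) → (s ⟶[ a ] s') ⇔ (s' ∈ succs))
  where open LTS L

data HML (A : Set) : Set₁ where
  T    : HML A
  ⋀    : (I : Set) → (I → HML A) → HML A
  ⟨_⟩_ : A → HML A → HML A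
  ¬'   : HML A → HML A

module _ {A : Set} (L : LTS A) where
  open LTS L
  infix 4 _⊨_
  _⊨_ : State → HML A → Set
  s ⊨ T = ⊤
  s ⊨ ⋀ I φ = ∀ (i : I) → s ⊨ φ i
  s ⊨ (⟨ a ⟩ φ) = ∃ λ s' → (s ⟶[ a ] s') × (s' ⊨ φ)
  s ⊨ ¬' φ = ¬ (s ⊨ φ)

-- Contexts, indexed by polarity (true = positive, false = negative),
-- generated exactly by the grammar of positive/negative contexts:
--   [] positive;  D[] ∧ ⋀_{i∈I} φ_i  and  ⟨a⟩D[]  keep polarity;  ¬D[] flips it.
data Ctx (A : Set) : Bool → Set₁ where
  hole : Ctx A true
  _∧ctx_,_ : ∀ {p} → Ctx A p → (I : Set) → (I → HML A) → Ctx A p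
  ⟨_⟩ctx_ : ∀ {p} → A → Ctx A p → Ctx A p
  ¬ctx : ∀ {p} → Ctx A p → Ctx A (not p)

_[_] : ∀ {A p} → Ctx A p → HML A → HML A
hole [ ψ ] = ψ
(D ∧ctx I , φ) [ ψ ] = ⋀ (⊤ ⊎ I) λ { (inj₁ _) → D [ ψ ] ; (inj₂ i) → φ i }
(⟨ a ⟩ctx D) [ ψ ] = ⟨ a ⟩ (D [ ψ ])
(¬ctx D) [ ψ ] = ¬' (D [ ψ ])

-- Conjunction over a finite subset J ⊆ I, J given by a finite list of elements of I:
-- ⋀_{i ∈ J} φ_i.
⋀fin : ∀ {A} {I : Set} → List I → (I → HML A) → HML A
⋀fin {I = I} J φ = ⋀ (Σ I (λ i → i ∈ J)) (λ { (i , _) → φ i })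

module Submission where

-- Let D[] be a context and write ⋀_J for ⋀_{i∈J} φ_i.
-- * Monotonicity: if ψ entails ψ' (at every state), then a positive context
--   gives D[ψ] ⊨ D[ψ'] and a negative one gives D[ψ'] ⊨ D[ψ].  As ⋀_I entails
--   every ⋀_J, this yields the "easy" half of both equivalences.
-- * Compactness: the converse halves are proved together by induction on D.
--   Conjunction and ¬ are routine (¬ swaps the two halves, using
--   ¬∀ ⇒ ∃¬ from excluded middle).  The essential case is ⟨a⟩ in positive
--   position: if for every finite J some a-successor satisfies D[⋀_J], then
--   one successor satisfies D[⋀_J] for all J at once.  Otherwise every one of
--   the finitely many successors fails some finite J_x; failure is upward
--   closed in J, so it persists at the finite union of the J_x, contradicting
--   the hypothesis for that union.  This is where image-finiteness is used.

open import Defs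
open import Level using (0ℓ)
open import Axiom.ExcludedMiddle using (ExcludedMiddle)
open import Data.Bool using (Bool; true; false)
open import Data.List using (List; []; _∷_; _++_)
open import Data.List.Membership.Propositional using (_∈_)
open import Data.List.Relation.Binary.Subset.Propositional using (_⊆_)
open import Data.List.Relation.Binary.Subset.Propositional.Properties
  using (xs⊆xs++ys; xs⊆ys++xs)
open import Data.List.Relation.Unary.Any using (here; there)
open import Data.Product using (_×_; ∃; _,_; proj₁; proj₂)
open import Data.Sum using (inj₁; inj₂)
open import Data.Unit using (tt)
open import Relation.Nullary using (¬_; yes; no; contradiction)
open import Relation.Binary.PropositionalEquality using (refl)
open import Function.Bundles using (_⇔_; mk⇔; Equivalence)

¬∀⇒∃¬ : ExcludedMiddle 0ℓ → {X : Set} (P : X → Set) →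
        ¬ (∀ x → P x) → ∃ λ x → ¬ P x
¬∀⇒∃¬ em P ¬∀P with em {∃ λ x → ¬ P x}
... | yes ∃¬P = ∃¬P
... | no ¬∃¬P = contradiction (λ x → holds x) ¬∀P
  where
  holds : ∀ x → P x
  holds x with em {P x}
  ... | yes Px = Px
  ... | no ¬Px = contradiction (x , ¬Px) ¬∃¬P

merge : {I X : Set} (Q : List I → X → Set) →
        (∀ {J J'} x → J ⊆ J' → Q J x → Q J' x) →
        (xs : List X) → (∀ x → x ∈ xs → ∃ λ J → Q J x) →
        ∃ λ J → ∀ x → x ∈ xs → Q J x
merge Q upward [] each = [] , λ _ ()
merge Q upward (y ∷ ys) each
  with each y (here refl) | merge Q upward ys (λ x x∈ys → each x (there x∈ys))
... | Jy , Qy | Jys , Qys = Jy ++ Jys , covered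
  where
  covered : ∀ x → x ∈ y ∷ ys → Q (Jy ++ Jys) x
  covered x (here refl) = upward x (xs⊆xs++ys Jy Jys) Qy
  covered x (there x∈ys) = upward x (xs⊆ys++xs Jys Jy) (Qys x x∈ys)

module _ {A : Set} (L : LTS A) where
  open LTS L

  _⊑_ : HML A → HML A → Set
  ψ ⊑ ψ' = ∀ t → _⊨_ L t ψ → _⊨_ L t ψ'

  Along : Bool → Set → Set → Set
  Along true X Y = X → Y
  Along false X Y = Y → X

  monotone : ∀ {p} (D : Ctx A p) {ψ ψ' : HML A} → ψ ⊑ ψ' →
             ∀ t → Along p (_⊨_ L t (D [ ψ ])) (_⊨_ L t (D [ ψ' ]))
  monotone hole ψ⊑ψ' t = ψ⊑ψ' t
  monotone {true} (D ∧ctx K , χ) ψ⊑ψ' t sat (inj₁ _) = monotone D ψ⊑ψ' t (sat (inj₁ tt))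
  monotone {true} (D ∧ctx K , χ) ψ⊑ψ' t sat (inj₂ k) = sat (inj₂ k)
  monotone {false} (D ∧ctx K , χ) ψ⊑ψ' t sat (inj₁ _) = monotone D ψ⊑ψ' t (sat (inj₁ tt))
  monotone {false} (D ∧ctx K , χ) ψ⊑ψ' t sat (inj₂ k) = sat (inj₂ k)
  monotone {true} (⟨ a ⟩ctx D) ψ⊑ψ' t (s' , tr , sat) = s' , tr , monotone D ψ⊑ψ' s' sat
  monotone {false} (⟨ a ⟩ctx D) ψ⊑ψ' t (s' , tr , sat) = s' , tr , monotone D ψ⊑ψ' s' sat
  monotone (¬ctx {true} D) ψ⊑ψ' t unsat sat = unsat (monotone D ψ⊑ψ' t sat)
  monotone (¬ctx {false} D) ψ⊑ψ' t unsat sat = unsat (monotone D ψ⊑ψ' t sat)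

  ⋀⊑⋀fin : {I : Set} (φ : I → HML A) → ∀ J → ⋀ I φ ⊑ ⋀fin J φ
  ⋀⊑⋀fin φ J t sat (i , _) = sat i

  ⋀fin-antitone : {I : Set} (φ : I → HML A) → ∀ {J J'} → J ⊆ J' → ⋀fin J' φ ⊑ ⋀fin J φ
  ⋀fin-antitone φ J⊆J' t sat (i , i∈J) = sat (i , J⊆J' i∈J)

  module Compactness (em : ExcludedMiddle 0ℓ) (fin : ImageFinite L) where

    diamond-compact : {I : Set} (P : List I → State → Set) →
      (∀ {J J'} x → J ⊆ J' → P J' x → P J x) →
      ∀ t a → (∀ J → ∃ λ s' → t ⟶[ a ] s' × P J s') →
      ∃ λ s' → t ⟶[ a ] s' × (∀ J → P J s')
    diamond-compact {I} P antitone t a someSucc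
      with em {∃ λ s' → t ⟶[ a ] s' × (∀ J → P J s')}
    ... | yes found = found
    ... | no none = contradiction Pbad (Jbad-fails s' (Equivalence.to (enum s') tr))
      where
      succs : List State
      succs = proj₁ (fin t a)
      enum : ∀ x → (t ⟶[ a ] x) ⇔ (x ∈ succs)
      enum = proj₂ (fin t a)

      fails-somewhere : ∀ x → x ∈ succs → ∃ λ J → ¬ P J x
      fails-somewhere x x∈ = ¬∀⇒∃¬ em (λ J → P J x)
        (λ allP → none (x , Equivalence.from (enum x) x∈ , allP))

      common : ∃ λ J → ∀ x → x ∈ succs → ¬ P J x
      common = merge (λ J x → ¬ P J x) (λ x J⊆J' ¬PJ PJ' → ¬PJ (antitone x J⊆J' PJ'))
                     succs fails-somewhere
      Jbad : List I
      Jbad = proj₁ common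
      Jbad-fails : ∀ x → x ∈ succs → ¬ P Jbad x
      Jbad-fails = proj₂ common
      s' : State
      s' = proj₁ (someSucc Jbad)
      tr : t ⟶[ a ] s'
      tr = proj₁ (proj₂ (someSucc Jbad))
      Pbad : P Jbad s'
      Pbad = proj₂ (proj₂ (someSucc Jbad))

    module _ {I : Set} (φ : I → HML A) where

      Compact : (p : Bool) → Ctx A p → State → Set
      Compact true D t = (∀ J → _⊨_ L t (D [ ⋀fin J φ ])) → _⊨_ L t (D [ ⋀ I φ ])
      Compact false D t = _⊨_ L t (D [ ⋀ I φ ]) → ∃ λ J → _⊨_ L t (D [ ⋀fin J φ ])

      compact : ∀ {p} (D : Ctx A p) t → Compact p D t
      compact hole t sat i = sat (i ∷ []) (i , here refl)
      compact {true} (D ∧ctx K , χ) t sat (inj₁ _) = compact D t (λ J → sat J (inj₁ tt))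
      compact {true} (D ∧ctx K , χ) t sat (inj₂ k) = sat [] (inj₂ k)
      compact {false} (D ∧ctx K , χ) t sat with compact D t (sat (inj₁ tt))
      ... | J , satJ = J , λ { (inj₁ _) → satJ ; (inj₂ k) → sat (inj₂ k) }
      compact {true} (⟨ a ⟩ctx D) t sat
        with diamond-compact (λ J x → _⊨_ L x (D [ ⋀fin J φ ]))
               (λ x J⊆J' → monotone D (⋀fin-antitone φ J⊆J') x) t a sat
      ... | s' , tr , satAll = s' , tr , compact D s' satAll
      compact {false} (⟨ a ⟩ctx D) t (s' , tr , sat) with compact D s' sat
      ... | J , satJ = J , s' , tr , satJ
      compact (¬ctx {true} D) t unsat =
        ¬∀⇒∃¬ em (λ J → _⊨_ L t (D [ ⋀fin J φ ])) (λ satAll → unsat (compact D t satAll))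
      compact (¬ctx {false} D) t unsatAll sat with compact D t sat
      ... | J , satJ = unsatAll J satJ

proposition4 : ExcludedMiddle 0ℓ → {A : Set} (L : LTS A) → ImageFinite L →
    (s : LTS.State L) (I : Set) (φ : I → HML A) →
    (∀ (D : Ctx A true) →
    _⊨_ L s (D [ ⋀ I φ ]) ⇔ (∀ (J : List I) → _⊨_ L s (D [ ⋀fin J φ ])))
    ×
    (∀ (D : Ctx A false) →
    _⊨_ L s (D [ ⋀ I φ ]) ⇔ (∃ λ (J : List I) → _⊨_ L s (D [ ⋀fin J φ ])))
proposition4 em L fin s I φ = positive , negative
  where
  open Compactness L em fin using (compact)
  positive : ∀ D → _⊨_ L s (D [ ⋀ I φ ]) ⇔ (∀ J → _⊨_ L s (D [ ⋀fin J φ ]))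
  positive D = mk⇔ (λ sat J → monotone L D (⋀⊑⋀fin L φ J) s sat) (compact φ D s)
  negative : ∀ D → _⊨_ L s (D [ ⋀ I φ ]) ⇔ (∃ λ J → _⊨_ L s (D [ ⋀fin J φ ]))
  negative D = mk⇔ (compact φ D s) (λ { (J , satJ) → monotone L D (⋀⊑⋀fin L φ J) s satJ })
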